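{- The values $(h(n))_{n=1}^{8}=(0,1,1,1,2,2,1,1)$, and for every $n\in\mathbb{N}$, \[ h(n)=\begin{cases} h(n/2) & \text{if } n\equiv 0 \pmod 4,\\ h(n/2)+1 & \text{if } n\equiv 2 \pmod 4,\\ h((n+1)/2) & \text{if } n\equiv 1 \pmod 8,\\ h((n-1)/2)+1 & \text{if } n\equiv 3 \pmod 8,\\ h((n+1)/2)+1 & \text{if } n\equiv 5 \pmod 8,\\ h((n-1)/2) & \text{if } n\equiv 7 \pmod 8. \end{cases} \] These initial values and this recurrence determine $h(n)$ for all $n\in\mathbb{N}$.
   Context: $\lg$ denotes the base-2 logarithm. For $i\in\mathbb{N}$ and $n\in\mathbb{N}_0$, $d_i(n)=2^{i-1}-\left|(n\bmod 2^i)-2^{i-1}\right|$. For $n\in\mathbb{N}$, $h(n)$ is one less than the number of distinct values in $\{d_i(n):i\in\mathbb{N}\}$; for $n\ge2$ this equals the number of pairs $(n_0,n_1)$ of integers with $n_0\ge n_1\ge1$, $n_0+n_1=n$ and $n_0-n_1=d_i(n)$ for some $i\in\{1,\ldots,\lceil\lg n\rceil\}$ (the hypercubic bipartitions of $n$). -}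

module Defs where

open import Data.Nat using (ℕ; zero; suc; _+_; _*_; _∸_; _^_; _≤_; ∣_-_∣)
open import Data.Nat.DivMod using (_%_; _/_)
open import Data.Nat.Properties using (m^n≢0)
open import Data.List using (List; length)
open import Data.List.Relation.Unary.Unique.Propositional using (Unique)
open import Data.List.Membership.Propositional using (_∈_)
open import Data.Product using (Σ; ∃; _×_)
open import Function.Bundles using (_⇔_)
open import Relation.Binary.PropositionalEquality using (_≡_)

d : ℕ → ℕ → ℕ
d i n = 2 ^ (i ∸ 1) ∸ ∣ _%_ n (2 ^ i) {{m^n≢0 2 i}} - 2 ^ (i ∸ 1) ∣

DValue : ℕ → ℕ → Set
DValue n v = ∃ λ i → 1 ≤ i × d i n ≡ v

-- IsH n k : k is one less than the number of distinct values in
-- { d i n : i ∈ ℕ }, i.e. that set is exactly the elements of some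
-- duplicate-free list of length k + 1.
IsH : ℕ → ℕ → Set
IsH n k = Σ (List ℕ) λ L → Unique L × length L ≡ suc k × (∀ v → (v ∈ L) ⇔ DValue n v)

Recurrence : (ℕ → ℕ) → ℕ → Set
Recurrence g n =
    (n % 4 ≡ 0 → g n ≡ g (n / 2))
  × (n % 4 ≡ 2 → g n ≡ g (n / 2) + 1)
  × (n % 8 ≡ 1 → g n ≡ g ((n + 1) / 2))
  × (n % 8 ≡ 3 → g n ≡ g ((n ∸ 1) / 2) + 1)
  × (n % 8 ≡ 5 → g n ≡ g ((n + 1) / 2) + 1)
  × (n % 8 ≡ 7 → g n ≡ g ((n ∸ 1) / 2))

InitialValues : (ℕ → ℕ) → Set
InitialValues g =
  g 1 ≡ 0 × g 2 ≡ 1 × g 3 ≡ 1 × g 4 ≡ 1 × g 5 ≡ 2 × g 6 ≡ 2 × g 7 ≡ 1 × g 8 ≡ 1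

-- d i n is the distance from n to the nearest multiple of 2^i.  Hence i ↦ d (1+i) n is
-- non-decreasing and reaches n once 2^i ≥ n, so h n is the number of times this chain rises.
-- Halving n gives d (1+i) (2k) = 2 d i k and d (1+i) (2k+1) = 1 + 2 min (d i k, d i (k+1)).
-- The first identity yields h (2k) = h k + [k odd].  For the second, min (d i q, d i (q+1))
-- rises from level i+1 to i+2 exactly when the binary digits i and i+1 of q differ, so
-- h (2q+1) counts the digit changes of q, which is h (2⌊q/2⌋+1) + [digits 0 and 1 of q differ].
-- These two rules are the six cases of the recurrence, and they fix h from h 1 by strong induction.

module Submission where

open import Defs
open import Data.Bool using (Bool; true; false; not; _xor_; if_then_else_; T)
open import Data.Bool.Properties using (T-≡; not-involutive; not-distribˡ-xor; not-distribʳ-xor)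
open import Data.Empty using (⊥-elim)
open import Data.Nat
  using (ℕ; zero; suc; _+_; _*_; _∸_; _^_; _≤_; _<_; _<ᵇ_; _⊓_; ∣_-_∣; ⌊_/2⌋; z≤n; s≤s; s≤s⁻¹; s<s; NonZero)
open import Data.Nat.Properties
open import Data.Nat.DivMod
  using (_%_; _/_; m≡m%n+[m/n]*n; m%n<n; [m+kn]%n≡m%n; m<n⇒m%n≡m; n%1≡0; m*n/n≡m)
open import Data.Nat.Induction using (<-rec)
open import Data.Nat.Tactic.RingSolver using (solve-∀)
open import Data.List using (List; []; _∷_; length)
open import Data.List.Relation.Unary.All as All using (All; []; _∷_)
open import Data.List.Relation.Unary.Any using (here; there)
open import Data.List.Relation.Unary.AllPairs using ([]; _∷_)
open import Data.List.Relation.Unary.Unique.Propositional using (Unique)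
open import Data.List.Membership.Propositional using (_∈_)
open import Data.Product using (Σ; ∃; _×_; _,_; proj₁; map)
open import Data.Sum using (inj₁; inj₂)
open import Function using (_∘_; id)
open import Function.Bundles using (_⇔_; mk⇔; Equivalence)
open import Relation.Nullary.Reflects using (det; fromEquivalence)
open import Relation.Binary.PropositionalEquality

-- Binary digits and counting

iverson : Bool → ℕ
iverson true  = 1
iverson false = 0

data Halving : ℕ → Set where
  even : ∀ k → Halving (2 * k)
  odd  : ∀ k → Halving (suc (2 * k))

halving : ∀ n → Halving n
halving zero = even 0
halving (suc n) with halving n
... | even k = odd k
... | odd k  = subst Halving (*-suc 2 k) (even (suc k))

⌊2*m/2⌋≡m : ∀ m → ⌊ 2 * m /2⌋ ≡ m
⌊2*m/2⌋≡m zero    = refl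
⌊2*m/2⌋≡m (suc m) = trans (cong ⌊_/2⌋ (*-suc 2 m)) (cong suc (⌊2*m/2⌋≡m m))

⌊1+2*m/2⌋≡m : ∀ m → ⌊ suc (2 * m) /2⌋ ≡ m
⌊1+2*m/2⌋≡m zero    = refl
⌊1+2*m/2⌋≡m (suc m) = trans (cong (⌊_/2⌋ ∘ suc) (*-suc 2 m)) (cong suc (⌊1+2*m/2⌋≡m m))

lowBit : ℕ → Bool
lowBit zero    = false
lowBit (suc n) = not (lowBit n)

lowBit-even : ∀ m → lowBit (2 * m) ≡ false
lowBit-even zero    = refl
lowBit-even (suc m) = trans (cong lowBit (*-suc 2 m)) (trans (not-involutive _) (lowBit-even m))

bit : ℕ → ℕ → Bool
bit zero    k = lowBit k
bit (suc j) k = bit j ⌊ k /2⌋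

bit-even : ∀ j m → bit (suc j) (2 * m) ≡ bit j m
bit-even j m = cong (bit j) (⌊2*m/2⌋≡m m)

bit-odd : ∀ j m → bit (suc j) (suc (2 * m)) ≡ bit j m
bit-odd j m = cong (bit j) (⌊1+2*m/2⌋≡m m)

bit-beyond : ∀ j k → k < 2 ^ j → bit j k ≡ false
bit-beyond zero    zero    _ = refl
bit-beyond zero    (suc k) (s≤s ())
bit-beyond (suc j) k k<2^1+j with halving k
... | even m = trans (bit-even j m) (bit-beyond j m (*-cancelˡ-< 2 m (2 ^ j) k<2^1+j))
... | odd m  = trans (bit-odd j m) (bit-beyond j m (*-cancelˡ-< 2 m (2 ^ j) (<-trans (n<1+n _) k<2^1+j)))

bitFlip : ℕ → ℕ → Bool
bitFlip j k = bit j k xor bit (suc j) k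

bitFlip-even : ∀ m → bitFlip 0 (2 * m) ≡ lowBit m
bitFlip-even m = cong₂ _xor_ (lowBit-even m) (bit-even 0 m)

bitFlip-odd : ∀ m → bitFlip 0 (suc (2 * m)) ≡ not (lowBit m)
bitFlip-odd m = cong₂ _xor_ (cong not (lowBit-even m)) (bit-odd 0 m)

n<2^n : ∀ n → n < 2 ^ n
n<2^n zero    = s≤s z≤n
n<2^n (suc n) = subst (suc (suc n) ≤_) (cong (2 ^ n +_) (sym (+-identityʳ (2 ^ n))))
                      (+-mono-≤ (m^n>0 2 n) (n<2^n n))

m≤n⇒m<2^n : ∀ {m n} → m ≤ n → m < 2 ^ n
m≤n⇒m<2^n {m} m≤n = <-≤-trans (n<2^n m) (^-monoʳ-≤ 2 m≤n)

bitFlip-beyond : ∀ j k → k ≤ j → bitFlip j k ≡ false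
bitFlip-beyond j k k≤j =
  cong₂ _xor_ (bit-beyond j k (m≤n⇒m<2^n k≤j)) (bit-beyond (suc j) k (m≤n⇒m<2^n (m≤n⇒m≤1+n k≤j)))

countBelow : (ℕ → Bool) → ℕ → ℕ
countBelow p zero    = 0
countBelow p (suc n) = iverson (p 0) + countBelow (p ∘ suc) n

countBelow-cong : ∀ {p q} → (∀ i → p i ≡ q i) → ∀ n → countBelow p n ≡ countBelow q n
countBelow-cong p≗q zero    = refl
countBelow-cong p≗q (suc n) = cong₂ _+_ (cong iverson (p≗q 0)) (countBelow-cong (p≗q ∘ suc) n)

countBelow-none : ∀ {p} → (∀ i → p i ≡ false) → ∀ n → countBelow p n ≡ 0
countBelow-none none zero    = refl
countBelow-none none (suc n) rewrite none 0 = countBelow-none (none ∘ suc) n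

countBelow-stable : ∀ p {m n} → (∀ i → m ≤ i → p i ≡ false) → m ≤ n →
                    countBelow p n ≡ countBelow p m
countBelow-stable p {zero}  {n}     none _         = countBelow-none (λ i → none i z≤n) n
countBelow-stable p {suc m} {suc n} none (s≤s m≤n) =
  cong (iverson (p 0) +_) (countBelow-stable (p ∘ suc) (λ i m≤i → none (suc i) (s≤s m≤i)) m≤n)

bitChanges : ℕ → ℕ
bitChanges q = countBelow (λ j → bitFlip j q) q

bitChanges-half : ∀ q → bitChanges q ≡ iverson (bitFlip 0 q) + bitChanges ⌊ q /2⌋
bitChanges-half zero    = refl
bitChanges-half (suc q) = cong (iverson (bitFlip 0 (suc q)) +_)
  (countBelow-stable _ (λ j → bitFlip-beyond j _) (s≤s⁻¹ (⌊n/2⌋<n q)))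

-- Monotone chains

Monotone : (ℕ → ℕ) → Set
Monotone F = ∀ i → F i ≤ F (suc i)

rises : (ℕ → ℕ) → ℕ → Bool
rises F i = F i <ᵇ F (suc i)

rises⇒< : ∀ F i → rises F i ≡ true → F i < F (suc i)
rises⇒< F i r = <ᵇ⇒< (F i) (F (suc i)) (Equivalence.from T-≡ r)

¬rises⇒≡ : ∀ {F} → Monotone F → ∀ i → rises F i ≡ false → F i ≡ F (suc i)
¬rises⇒≡ mono i r = ≤-antisym (mono i) (≮⇒≥ (λ lt → subst T r (<⇒<ᵇ lt)))

distinctValues : (ℕ → ℕ) → ℕ → List ℕ
distinctValues F zero    = F 0 ∷ []
distinctValues F (suc n) =
  if rises F 0 then F 0 ∷ distinctValues (F ∘ suc) n else distinctValues (F ∘ suc) n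

distinctValues-≥ : ∀ F → Monotone F → ∀ n → All (F 0 ≤_) (distinctValues F n)
distinctValues-≥ F mono zero = ≤-refl ∷ []
distinctValues-≥ F mono (suc n) with rises F 0
... | true  = ≤-refl ∷ All.map (≤-trans (mono 0)) (distinctValues-≥ (F ∘ suc) (mono ∘ suc) n)
... | false = All.map (≤-trans (mono 0)) (distinctValues-≥ (F ∘ suc) (mono ∘ suc) n)

distinctValues-unique : ∀ F → Monotone F → ∀ n → Unique (distinctValues F n)
distinctValues-unique F mono zero = [] ∷ []
distinctValues-unique F mono (suc n) with rises F 0 in r
... | true  = All.map (λ F1≤v F0≡v → <⇒≱ (rises⇒< F 0 r) (subst (F 1 ≤_) (sym F0≡v) F1≤v))
                      (distinctValues-≥ (F ∘ suc) (mono ∘ suc) n)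
              ∷ distinctValues-unique (F ∘ suc) (mono ∘ suc) n
... | false = distinctValues-unique (F ∘ suc) (mono ∘ suc) n

length-distinctValues : ∀ F n → length (distinctValues F n) ≡ suc (countBelow (rises F) n)
length-distinctValues F zero = refl
length-distinctValues F (suc n) with rises F 0
... | true  = cong suc (length-distinctValues (F ∘ suc) n)
... | false = length-distinctValues (F ∘ suc) n

∈-distinctValues⁺ : ∀ F → Monotone F → ∀ {j} n → j ≤ n → F j ∈ distinctValues F n
∈-distinctValues⁺ F mono {zero} zero _ = here refl
∈-distinctValues⁺ F mono {j} (suc n) j≤1+n with rises F 0 in r | j | j≤1+n
... | true  | zero  | _       = here refl
... | false | zero  | _       = subst (_∈ distinctValues (F ∘ suc) n) (sym (¬rises⇒≡ mono 0 r))
                                      (∈-distinctValues⁺ (F ∘ suc) (mono ∘ suc) n z≤n)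
... | true  | suc i | s≤s i≤n = there (∈-distinctValues⁺ (F ∘ suc) (mono ∘ suc) n i≤n)
... | false | suc i | s≤s i≤n = ∈-distinctValues⁺ (F ∘ suc) (mono ∘ suc) n i≤n

∈-distinctValues⁻ : ∀ F n {v} → v ∈ distinctValues F n → ∃ λ j → F j ≡ v
∈-distinctValues⁻ F zero (here v≡F0) = 0 , sym v≡F0
∈-distinctValues⁻ F (suc n) v∈ with rises F 0 | v∈
... | true  | here v≡F0 = 0 , sym v≡F0
... | true  | there v∈′ = map suc id (∈-distinctValues⁻ (F ∘ suc) n v∈′)
... | false | v∈′       = map suc id (∈-distinctValues⁻ (F ∘ suc) n v∈′)

∈-distinctValues : ∀ F → Monotone F → ∀ n → (∀ j → n ≤ j → F j ≡ F n) →
                   ∀ v → v ∈ distinctValues F n ⇔ ∃ λ j → F j ≡ v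
∈-distinctValues F mono n stable v = mk⇔ (∈-distinctValues⁻ F n) λ { (j , refl) → attained j }
  where
    attained : ∀ j → F j ∈ distinctValues F n
    attained j with ≤-total j n
    ... | inj₁ j≤n = ∈-distinctValues⁺ F mono n j≤n
    ... | inj₂ n≤j = subst (_∈ distinctValues F n) (sym (stable j n≤j))
                           (∈-distinctValues⁺ F mono n ≤-refl)

<ᵇ-irrefl : ∀ n → (n <ᵇ n) ≡ false
<ᵇ-irrefl zero    = refl
<ᵇ-irrefl (suc n) = <ᵇ-irrefl n

<ᵇ-cong : ∀ {a b c e} → (a < b → c < e) → (c < e → a < b) → (a <ᵇ b) ≡ (c <ᵇ e)
<ᵇ-cong {a} {b} {c} {e} to from =
  det (<ᵇ-reflects-< a b) (fromEquivalence (from ∘ <ᵇ⇒< c e) (<⇒<ᵇ ∘ to))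

2*m<ᵇ2*n≡m<ᵇn : ∀ m n → (2 * m <ᵇ 2 * n) ≡ (m <ᵇ n)
2*m<ᵇ2*n≡m<ᵇn m n = <ᵇ-cong (*-cancelˡ-< 2 m n) (*-monoʳ-< 2)

data Step : ℕ → ℕ → Bool → Set where
  up   : ∀ {x y} → x < y → Step x y true
  flat : ∀ {x} → Step x x false

Step⇒<ᵇ : ∀ {x y b} → Step x y b → (x <ᵇ y) ≡ b
Step⇒<ᵇ (up x<y) = Equivalence.to T-≡ (<⇒<ᵇ x<y)
Step⇒<ᵇ {x} flat = <ᵇ-irrefl x

Step-resp : ∀ {x x′ y y′ b b′} → x ≡ x′ → y ≡ y′ → b ≡ b′ → Step x y b → Step x′ y′ b′
Step-resp refl refl refl s = s

Step-iverson : ∀ b → Step 0 (iverson b) b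
Step-iverson true  = up (s≤s z≤n)
Step-iverson false = flat

m<n⇒1+2m<2n : ∀ {m n} → m < n → suc (2 * m) < 2 * n
m<n⇒1+2m<2n {m} {n} m<n = subst (_≤ 2 * n) (*-suc 2 m) (*-monoʳ-≤ 2 m<n)

Step-double : ∀ {a b c} β β′ → β xor β′ ≡ c → Step a b c →
              Step (2 * a + iverson β) (2 * b + iverson β′) c
Step-double {a} {b} β β′ _ (up a<b) = up (begin-strict
  2 * a + iverson β   ≤⟨ +-monoʳ-≤ (2 * a) (iverson≤1 β) ⟩
  2 * a + 1           ≡⟨ +-comm (2 * a) 1 ⟩
  suc (2 * a)         <⟨ m<n⇒1+2m<2n a<b ⟩
  2 * b               ≤⟨ m≤m+n (2 * b) (iverson β′) ⟩
  2 * b + iverson β′  ∎)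
  where
    open ≤-Reasoning
    iverson≤1 : ∀ β → iverson β ≤ 1
    iverson≤1 true  = ≤-refl
    iverson≤1 false = z≤n
Step-double false false refl flat = flat
Step-double true  true  refl flat = flat

-- Distance to the nearest multiple of a power of two

n≡r+q*m⇒n%m≡r : ∀ {n} r q m .{{_ : NonZero m}} → r < m → n ≡ r + q * m → n % m ≡ r
n≡r+q*m⇒n%m≡r r q m r<m refl = trans ([m+kn]%n≡m%n r q m) (m<n⇒m%n≡m r<m)

residue : ℕ → ℕ → ℕ
residue i n = _%_ n (2 ^ i) {{m^n≢0 2 i}}

module _ (i k : ℕ) where
  private
    instance
      2^i≢0 : NonZero (2 ^ i)
      2^i≢0 = m^n≢0 2 i
      2^1+i≢0 : NonZero (2 ^ suc i)
      2^1+i≢0 = m^n≢0 2 (suc i)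
    ρ = residue i k
    q = k / 2 ^ i

    double : ∀ r s P → 2 * (r + s * P) ≡ 2 * r + s * (2 * P)
    double = solve-∀

    2k≡ : 2 * k ≡ 2 * ρ + q * 2 ^ suc i
    2k≡ = trans (cong (2 *_) (m≡m%n+[m/n]*n k (2 ^ i))) (double ρ q (2 ^ i))

  residue-even : residue (suc i) (2 * k) ≡ 2 * ρ
  residue-even = n≡r+q*m⇒n%m≡r (2 * ρ) q (2 ^ suc i) (*-monoʳ-< 2 (m%n<n k (2 ^ i))) 2k≡

  residue-odd : residue (suc i) (suc (2 * k)) ≡ suc (2 * ρ)
  residue-odd = n≡r+q*m⇒n%m≡r (suc (2 * ρ)) q (2 ^ suc i) (m<n⇒1+2m<2n (m%n<n k (2 ^ i))) (cong suc 2k≡)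

  residue-suc : suc ρ < 2 ^ i → residue i (suc k) ≡ suc ρ
  residue-suc lt = n≡r+q*m⇒n%m≡r (suc ρ) q (2 ^ i) lt (cong suc (m≡m%n+[m/n]*n k (2 ^ i)))

  residue-wrap : suc ρ ≡ 2 ^ i → residue i (suc k) ≡ 0
  residue-wrap eq = n≡r+q*m⇒n%m≡r 0 (suc q) (2 ^ i) (m^n>0 2 i)
    (trans (cong suc (m≡m%n+[m/n]*n k (2 ^ i))) (cong (_+ q * 2 ^ i) eq))

nearest : ℕ → ℕ → ℕ
nearest P r = r ⊓ (P ∸ r)

tent : ∀ H r → r ≤ 2 * H → H ∸ ∣ r - H ∣ ≡ nearest (2 * H) r
tent H r r≤2H with ≤-total r H
... | inj₁ r≤H = begin
    H ∸ ∣ r - H ∣      ≡⟨ cong (H ∸_) (m≤n⇒∣m-n∣≡n∸m r≤H) ⟩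
    H ∸ (H ∸ r)        ≡⟨ m∸[m∸n]≡n r≤H ⟩
    r                  ≡⟨ m≤n⇒m⊓n≡m r≤2H∸r ⟨
    nearest (2 * H) r  ∎
  where
    open ≡-Reasoning
    r≤2H∸r : r ≤ 2 * H ∸ r
    r≤2H∸r = m+n≤o⇒m≤o∸n r
      (subst (r + r ≤_) (cong (H +_) (sym (+-identityʳ H))) (+-mono-≤ r≤H r≤H))
... | inj₂ H≤r = subst (λ r → H ∸ ∣ r - H ∣ ≡ nearest (2 * H) r) (m+[n∸m]≡n H≤r) (upper (r ∸ H))
  where
    open ≡-Reasoning
    upper : ∀ t → H ∸ ∣ (H + t) - H ∣ ≡ nearest (2 * H) (H + t)
    upper t = begin
      H ∸ ∣ (H + t) - H ∣      ≡⟨ cong (H ∸_) (trans (m≤n⇒∣n-m∣≡n∸m (m≤m+n H t)) (m+n∸m≡n H t)) ⟩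
      H ∸ t                    ≡⟨ m≥n⇒m⊓n≡n (≤-trans (m∸n≤m H t) (m≤m+n H t)) ⟨
      (H + t) ⊓ (H ∸ t)        ≡⟨ cong (λ x → (H + t) ⊓ (x ∸ t)) (+-identityʳ H) ⟨
      (H + t) ⊓ (H + 0 ∸ t)    ≡⟨ cong ((H + t) ⊓_) ([m+n]∸[m+o]≡n∸o H (H + 0) t) ⟨
      nearest (2 * H) (H + t)  ∎

nearest-double : ∀ P r → nearest (2 * P) (2 * r) ≡ 2 * nearest P r
nearest-double P r = begin
  (2 * r) ⊓ (2 * P ∸ 2 * r)  ≡⟨ cong ((2 * r) ⊓_) (*-distribˡ-∸ 2 P r) ⟨
  (2 * r) ⊓ (2 * (P ∸ r))    ≡⟨ *-distribˡ-⊓ 2 r (P ∸ r) ⟨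
  2 * nearest P r            ∎
  where open ≡-Reasoning

⊓-neighbours : ∀ a b → (a ⊓ suc b) ⊓ (suc a ⊓ b) ≡ a ⊓ b
⊓-neighbours zero    b       = refl
⊓-neighbours (suc a) zero    = ⊓-zeroʳ (suc a ⊓ 1)
⊓-neighbours (suc a) (suc b) = cong suc (⊓-neighbours a b)

nearest-odd : ∀ {P} r → suc r < P →
              nearest (2 * P) (suc (2 * r)) ≡ suc (2 * (nearest P r ⊓ nearest P (suc r)))
nearest-odd {P} r 1+r<P =
  subst (λ P → nearest (2 * P) (suc (2 * r)) ≡ suc (2 * (nearest P r ⊓ nearest P (suc r))))
        (m+[n∸m]≡n (<⇒≤ 1+r<P)) (interior (P ∸ suc r))
  where
    open ≡-Reasoning
    split : ∀ r s → 2 * suc (r + s) ≡ suc (2 * r) + suc (2 * s)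
    split = solve-∀
    interior : ∀ s → nearest (2 * suc (r + s)) (suc (2 * r)) ≡
                     suc (2 * (nearest (suc (r + s)) r ⊓ nearest (suc (r + s)) (suc r)))
    interior s = begin
      suc (2 * r) ⊓ (2 * suc (r + s) ∸ suc (2 * r))
        ≡⟨ cong (λ x → suc (2 * r) ⊓ (x ∸ suc (2 * r))) (split r s) ⟩
      suc (2 * r) ⊓ (suc (2 * r) + suc (2 * s) ∸ suc (2 * r))
        ≡⟨ cong (suc (2 * r) ⊓_) (m+n∸m≡n (suc (2 * r)) (suc (2 * s))) ⟩
      suc ((2 * r) ⊓ (2 * s))
        ≡⟨ cong suc (*-distribˡ-⊓ 2 r s) ⟨
      suc (2 * (r ⊓ s))
        ≡⟨ cong (λ x → suc (2 * x)) (⊓-neighbours r s) ⟨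
      suc (2 * ((r ⊓ suc s) ⊓ (suc r ⊓ s)))
        ≡⟨ cong₂ (λ a b → suc (2 * ((r ⊓ a) ⊓ (suc r ⊓ b))))
                 (trans (cong (_∸ r) (sym (+-suc r s))) (m+n∸m≡n r (suc s))) (m+n∸m≡n r s) ⟨
      suc (2 * (nearest (suc (r + s)) r ⊓ nearest (suc (r + s)) (suc r)))
        ∎

nearest-wrap : ∀ {P} r → suc r ≡ P →
               nearest (2 * P) (suc (2 * r)) ≡ suc (2 * (nearest P r ⊓ nearest P 0))
nearest-wrap r refl = begin
  suc (2 * r) ⊓ (2 * suc r ∸ suc (2 * r))  ≡⟨ cong (λ x → suc (2 * r) ⊓ (x ∸ suc (2 * r))) (*-suc 2 r) ⟩
  suc (2 * r) ⊓ (suc (2 * r) ∸ 2 * r)      ≡⟨ cong (suc (2 * r) ⊓_) (m+n∸n≡m 1 (2 * r)) ⟩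
  suc ((2 * r) ⊓ 0)                         ≡⟨ cong suc (⊓-zeroʳ (2 * r)) ⟩
  1                                         ≡⟨ cong (λ x → suc (2 * x)) (⊓-zeroʳ (nearest (suc r) r)) ⟨
  suc (2 * (nearest (suc r) r ⊓ 0))         ∎
  where open ≡-Reasoning

d-distance : ∀ i n → d i n ≡ nearest (2 ^ i) (residue i n)
d-distance zero    n rewrite n%1≡0 n = refl
d-distance (suc i) n = tent (2 ^ i) (residue (suc i) n) (<⇒≤ (m%n<n n (2 ^ suc i) {{m^n≢0 2 (suc i)}}))

d-zero : ∀ n → d 0 n ≡ 0
d-zero n rewrite n%1≡0 n = refl

d-even : ∀ i k → d (suc i) (2 * k) ≡ 2 * d i k
d-even i k = begin
  d (suc i) (2 * k)                              ≡⟨ d-distance (suc i) (2 * k) ⟩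
  nearest (2 * 2 ^ i) (residue (suc i) (2 * k))  ≡⟨ cong (nearest (2 * 2 ^ i)) (residue-even i k) ⟩
  nearest (2 * 2 ^ i) (2 * residue i k)          ≡⟨ nearest-double (2 ^ i) (residue i k) ⟩
  2 * nearest (2 ^ i) (residue i k)              ≡⟨ cong (2 *_) (d-distance i k) ⟨
  2 * d i k                                      ∎
  where open ≡-Reasoning

d-even′ : ∀ i k → d (suc i) (suc (suc (2 * k))) ≡ 2 * d i (suc k)
d-even′ i k = trans (cong (d (suc i)) (sym (*-suc 2 k))) (d-even i (suc k))

dEdge : ℕ → ℕ → ℕ
dEdge i k = d i k ⊓ d i (suc k)

dEdge-zero : ∀ k → dEdge 0 k ≡ 0
dEdge-zero k = cong₂ _⊓_ (d-zero k) (d-zero (suc k))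

d-odd : ∀ i k → d (suc i) (suc (2 * k)) ≡ suc (2 * dEdge i k)
d-odd i k = begin
  d (suc i) (suc (2 * k))                                  ≡⟨ d-distance (suc i) (suc (2 * k)) ⟩
  nearest (2 * P) (residue (suc i) (suc (2 * k)))          ≡⟨ cong (nearest (2 * P)) (residue-odd i k) ⟩
  nearest (2 * P) (suc (2 * ρ))                            ≡⟨ odd-residue ⟩
  suc (2 * (nearest P ρ ⊓ nearest P (residue i (suc k))))  ≡⟨ cong₂ (λ a b → suc (2 * (a ⊓ b)))
                                                                     (d-distance i k) (d-distance i (suc k)) ⟨
  suc (2 * dEdge i k)                                      ∎
  where
    open ≡-Reasoning
    P = 2 ^ i
    ρ = residue i k
    next : ∀ {r} → residue i (suc k) ≡ r →
           suc (2 * (nearest P ρ ⊓ nearest P r)) ≡ suc (2 * (nearest P ρ ⊓ nearest P (residue i (suc k))))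
    next eq = cong (λ r → suc (2 * (nearest P ρ ⊓ nearest P r))) (sym eq)
    odd-residue : nearest (2 * P) (suc (2 * ρ)) ≡ suc (2 * (nearest P ρ ⊓ nearest P (residue i (suc k))))
    odd-residue with m≤n⇒m<n∨m≡n (m%n<n k P {{m^n≢0 2 i}})
    ... | inj₁ lt = trans (nearest-odd ρ lt) (next (residue-suc i k lt))
    ... | inj₂ eq = trans (nearest-wrap ρ eq) (next (residue-wrap i k eq))

d-saturates : ∀ i n → n ≤ 2 ^ i → d (suc i) n ≡ n
d-saturates i n n≤P = begin
  d (suc i) n                          ≡⟨ d-distance (suc i) n ⟩
  nearest (2 * P) (residue (suc i) n)  ≡⟨ cong (nearest (2 * P)) (m<n⇒m%n≡m {{m^n≢0 2 (suc i)}} n<2P) ⟩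
  n ⊓ (2 * P ∸ n)                      ≡⟨ m≤n⇒m⊓n≡m (m+n≤o⇒m≤o∸n n n+n≤2P) ⟩
  n                                    ∎
  where
    open ≡-Reasoning
    P = 2 ^ i
    n<2P : n < 2 * P
    n<2P = ≤-<-trans n≤P (m<m+n P (subst (0 <_) (sym (+-identityʳ P)) (m^n>0 2 i)))
    n+n≤2P : n + n ≤ 2 * P
    n+n≤2P = subst (n + n ≤_) (cong (P +_) (sym (+-identityʳ P))) (+-mono-≤ n≤P n≤P)

d-monotone : ∀ i n → d i n ≤ d (suc i) n
d-monotone zero    n rewrite d-zero n = z≤n
d-monotone (suc i) n with halving n
... | even m rewrite d-even i m | d-even (suc i) m = *-monoʳ-≤ 2 (d-monotone i m)
... | odd m  rewrite d-odd i m  | d-odd (suc i) m  =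
  s≤s (*-monoʳ-≤ 2 (⊓-mono-≤ (d-monotone i m) (d-monotone i (suc m))))

d-one : ∀ k → d 1 k ≡ iverson (lowBit k)
d-one k with halving k
... | even m = trans (d-even 0 m) (trans (cong (2 *_) (d-zero m)) (cong iverson (sym (lowBit-even m))))
... | odd m  = trans (d-odd 0 m) (trans (cong (λ x → suc (2 * x)) (dEdge-zero m))
                                        (cong (iverson ∘ not) (sym (lowBit-even m))))

OrderedBy : Bool → ℕ → ℕ → Set
OrderedBy false x y = x < y
OrderedBy true  x y = y < x

odd-below-even : ∀ {a b c} → a ≤ b → b < c → suc (2 * a) < 2 * c
odd-below-even a≤b b<c = ≤-<-trans (s≤s (*-monoʳ-≤ 2 a≤b)) (m<n⇒1+2m<2n b<c)

even-below-odd : ∀ {a b} → a ≤ b → 2 * a < suc (2 * b)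
even-below-odd a≤b = s≤s (*-monoʳ-≤ 2 a≤b)

-- k mod 2^(1+j) lies on the rising half of the tent of height 2^j exactly when bit j of k is 0.
d-neighbours : ∀ j k → OrderedBy (bit j k) (d (suc j) k) (d (suc j) (suc k))
d-neighbours zero k =
  subst₂ (OrderedBy (lowBit k)) (sym (d-one k)) (sym (d-one (suc k))) (iverson-ordered (lowBit k))
  where
    iverson-ordered : ∀ b → OrderedBy b (iverson b) (iverson (not b))
    iverson-ordered false = s≤s z≤n
    iverson-ordered true  = s≤s z≤n
d-neighbours (suc j) k with halving k
... | even m rewrite bit-even j m | d-even (suc j) m | d-odd (suc j) m with bit j m | d-neighbours j m
...   | false | A<B = even-below-odd (⊓-glb ≤-refl (<⇒≤ A<B))
...   | true  | B<A = odd-below-even (m⊓n≤n (d (suc j) m) (d (suc j) (suc m))) B<A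
d-neighbours (suc j) k | odd m
  rewrite bit-odd j m | d-odd (suc j) m | d-even′ (suc j) m with bit j m | d-neighbours j m
...   | false | A<B = odd-below-even (m⊓n≤m (d (suc j) m) (d (suc j) (suc m))) A<B
...   | true  | B<A = even-below-odd (⊓-glb (<⇒≤ B<A) (≤-refl {d (suc j) (suc m)}))

⊓-even-odd : ∀ b A B → OrderedBy b A B → (2 * A) ⊓ suc (2 * (A ⊓ B)) ≡ 2 * (A ⊓ B) + iverson b
⊓-even-odd false A B A<B rewrite m≤n⇒m⊓n≡m (<⇒≤ A<B) =
  trans (m≤n⇒m⊓n≡m (n≤1+n (2 * A))) (sym (+-identityʳ (2 * A)))
⊓-even-odd true  A B B<A rewrite m≥n⇒m⊓n≡n (<⇒≤ B<A) =
  trans (m≥n⇒m⊓n≡n (<⇒≤ (m<n⇒1+2m<2n B<A))) (+-comm 1 (2 * B))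

⊓-odd-even : ∀ b A B → OrderedBy b A B → suc (2 * (A ⊓ B)) ⊓ (2 * B) ≡ 2 * (A ⊓ B) + iverson (not b)
⊓-odd-even false A B A<B rewrite m≤n⇒m⊓n≡m (<⇒≤ A<B) =
  trans (m≤n⇒m⊓n≡m (<⇒≤ (m<n⇒1+2m<2n A<B))) (+-comm 1 (2 * A))
⊓-odd-even true  A B B<A rewrite m≥n⇒m⊓n≡n (<⇒≤ B<A) =
  trans (m≥n⇒m⊓n≡n (n≤1+n (2 * B))) (sym (+-identityʳ (2 * B)))

dEdge-one : ∀ k → dEdge 1 k ≡ 0
dEdge-one k rewrite d-one k | d-one (suc k) with lowBit k
... | false = refl
... | true  = refl

dEdge-even : ∀ j m → dEdge (suc (suc j)) (2 * m) ≡ 2 * dEdge (suc j) m + iverson (bit j m)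
dEdge-even j m = trans (cong₂ _⊓_ (d-even (suc j) m) (d-odd (suc j) m))
                       (⊓-even-odd (bit j m) (d (suc j) m) (d (suc j) (suc m)) (d-neighbours j m))

dEdge-odd : ∀ j m → dEdge (suc (suc j)) (suc (2 * m)) ≡ 2 * dEdge (suc j) m + iverson (not (bit j m))
dEdge-odd j m = trans (cong₂ _⊓_ (d-odd (suc j) m) (d-even′ (suc j) m))
                      (⊓-odd-even (bit j m) (d (suc j) m) (d (suc j) (suc m)) (d-neighbours j m))

dEdge-step : ∀ i q → Step (dEdge (suc i) q) (dEdge (suc (suc i)) q) (bitFlip i q)
dEdge-step zero q with halving q
... | even m = Step-resp (sym (dEdge-one (2 * m)))
                         (sym (trans (dEdge-even 0 m) (cong (λ e → 2 * e + iverson (lowBit m)) (dEdge-one m))))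
                         (sym (bitFlip-even m)) (Step-iverson (lowBit m))
... | odd m  = Step-resp (sym (dEdge-one (suc (2 * m))))
                         (sym (trans (dEdge-odd 0 m)
                                     (cong (λ e → 2 * e + iverson (not (lowBit m))) (dEdge-one m))))
                         (sym (bitFlip-odd m)) (Step-iverson (not (lowBit m)))
dEdge-step (suc i) q with halving q
... | even m = Step-resp (sym (dEdge-even i m)) (sym (dEdge-even (suc i) m))
                         (cong (bitFlip i) (sym (⌊2*m/2⌋≡m m)))
                         (Step-double (bit i m) (bit (suc i) m) refl (dEdge-step i m))
... | odd m  = Step-resp (sym (dEdge-odd i m)) (sym (dEdge-odd (suc i) m))
                         (cong (bitFlip i) (sym (⌊1+2*m/2⌋≡m m)))
                         (Step-double (not (bit i m)) (not (bit (suc i) m)) (not-xor-not (bit i m) _)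
                                      (dEdge-step i m))
  where
    not-xor-not : ∀ x y → not x xor not y ≡ x xor y
    not-xor-not x y = trans (sym (not-distribˡ-xor x (not y)))
                            (trans (cong not (sym (not-distribʳ-xor x y))) (not-involutive (x xor y)))

-- The function h

dChain : ℕ → ℕ → ℕ
dChain n i = d (suc i) n

h : ℕ → ℕ
h n = countBelow (rises (dChain n)) n

dChain-stable : ∀ n j → n ≤ j → dChain n j ≡ n
dChain-stable n j n≤j = d-saturates j n (<⇒≤ (m≤n⇒m<2^n n≤j))

h-isH : ∀ n → IsH n (h n)
h-isH n = distinctValues F n , distinctValues-unique F mono n , length-distinctValues F n ,
          λ v → mk⇔ (reindex⁺ ∘ Equivalence.to (members v)) (Equivalence.from (members v) ∘ reindex⁻)
  where
    F = dChain n
    mono : Monotone F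
    mono i = d-monotone (suc i) n
    members : ∀ v → v ∈ distinctValues F n ⇔ ∃ (λ j → F j ≡ v)
    members = ∈-distinctValues F mono n
                (λ j n≤j → trans (dChain-stable n j n≤j) (sym (dChain-stable n n ≤-refl)))
    reindex⁺ : ∀ {v} → ∃ (λ j → F j ≡ v) → DValue n v
    reindex⁺ (j , e) = suc j , s≤s z≤n , e
    reindex⁻ : ∀ {v} → DValue n v → ∃ (λ j → F j ≡ v)
    reindex⁻ (suc j , _ , e) = j , e

h-initialValues : InitialValues h
h-initialValues = refl , refl , refl , refl , refl , refl , refl , refl

rises-dChain-beyond : ∀ n i → n ≤ i → rises (dChain n) i ≡ false
rises-dChain-beyond n i n≤i =
  trans (cong₂ _<ᵇ_ (dChain-stable n i n≤i) (dChain-stable n (suc i) (m≤n⇒m≤1+n n≤i))) (<ᵇ-irrefl n)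

rises-dChain-even₀ : ∀ k → rises (dChain (2 * k)) 0 ≡ lowBit k
rises-dChain-even₀ k = trans (cong₂ _<ᵇ_ (trans (d-even 0 k) (cong (2 *_) (d-zero k)))
                                         (trans (d-even 1 k) (cong (2 *_) (d-one k))))
                             (positive (lowBit k))
  where
    positive : ∀ b → (0 <ᵇ 2 * iverson b) ≡ b
    positive true  = refl
    positive false = refl

rises-dChain-even : ∀ k i → rises (dChain (2 * k)) (suc i) ≡ rises (dChain k) i
rises-dChain-even k i = trans (cong₂ _<ᵇ_ (d-even (suc i) k) (d-even (suc (suc i)) k))
                              (2*m<ᵇ2*n≡m<ᵇn (d (suc i) k) (d (suc (suc i)) k))

rises-dChain-odd₀ : ∀ q → rises (dChain (suc (2 * q))) 0 ≡ false
rises-dChain-odd₀ q = cong₂ _<ᵇ_ (trans (d-odd 0 q) (cong (λ e → suc (2 * e)) (dEdge-zero q)))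
                                 (trans (d-odd 1 q) (cong (λ e → suc (2 * e)) (dEdge-one q)))

rises-dChain-odd : ∀ q i → rises (dChain (suc (2 * q))) (suc i) ≡ bitFlip i q
rises-dChain-odd q i = trans (cong₂ _<ᵇ_ (d-odd (suc i) q) (d-odd (suc (suc i)) q))
                             (trans (2*m<ᵇ2*n≡m<ᵇn (dEdge (suc i) q) (dEdge (suc (suc i)) q))
                                    (Step⇒<ᵇ (dEdge-step i q)))

h-even : ∀ {k} → 1 ≤ k → h (2 * k) ≡ iverson (lowBit k) + h k
h-even {suc k} _ = cong₂ _+_ (cong iverson (rises-dChain-even₀ (suc k)))
  (trans (countBelow-cong (rises-dChain-even (suc k)) (k + suc (k + 0)))
         (countBelow-stable _ (rises-dChain-beyond (suc k)) (≤-trans (s≤s (m≤m+n k 0)) (m≤n+m _ k))))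

h-odd : ∀ q → h (suc (2 * q)) ≡ bitChanges q
h-odd q = cong₂ _+_ (cong iverson (rises-dChain-odd₀ q))
  (trans (countBelow-cong (rises-dChain-odd q) (2 * q))
         (countBelow-stable _ (λ j → bitFlip-beyond j q) (m≤m+n q (q + 0))))

h-odd-half : ∀ q → h (suc (2 * q)) ≡ iverson (bitFlip 0 q) + h (suc (2 * ⌊ q /2⌋))
h-odd-half q = begin
  h (suc (2 * q))                                  ≡⟨ h-odd q ⟩
  bitChanges q                                     ≡⟨ bitChanges-half q ⟩
  iverson (bitFlip 0 q) + bitChanges ⌊ q /2⌋       ≡⟨ cong (iverson (bitFlip 0 q) +_) (h-odd ⌊ q /2⌋) ⟨
  iverson (bitFlip 0 q) + h (suc (2 * ⌊ q /2⌋))    ∎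
  where open ≡-Reasoning

h-odd-even : ∀ m → h (suc (2 * (2 * m))) ≡ iverson (lowBit m) + h (suc (2 * m))
h-odd-even m = trans (h-odd-half (2 * m))
                     (cong₂ (λ b x → iverson b + h (suc (2 * x))) (bitFlip-even m) (⌊2*m/2⌋≡m m))

h-odd-odd : ∀ m → h (suc (2 * suc (2 * m))) ≡ iverson (not (lowBit m)) + h (suc (2 * m))
h-odd-odd m = trans (h-odd-half (suc (2 * m)))
                    (cong₂ (λ b x → iverson b + h (suc (2 * x))) (bitFlip-odd m) (⌊1+2*m/2⌋≡m m))

-- The recurrence

-- The residue classes of the corollary, written in binary so that the halving lemmas apply.
record ResidueRecurrence (g : ℕ → ℕ) : Set where
  field
    case-4t   : ∀ t → g (2 * (2 * suc t)) ≡ g (2 * suc t)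
    case-4t+2 : ∀ t → g (2 * suc (2 * t)) ≡ g (suc (2 * t)) + 1
    case-8t+1 : ∀ t → g (suc (2 * (2 * (2 * t)))) ≡ g (suc (2 * (2 * t)))
    case-8t+3 : ∀ t → g (suc (2 * suc (2 * (2 * t)))) ≡ g (suc (2 * (2 * t))) + 1
    case-8t+5 : ∀ t → g (suc (2 * (2 * suc (2 * t)))) ≡ g (suc (2 * suc (2 * t))) + 1
    case-8t+7 : ∀ t → g (suc (2 * suc (2 * suc (2 * t)))) ≡ g (suc (2 * suc (2 * t)))

h-residueRecurrence : ResidueRecurrence h
h-residueRecurrence = record
  { case-4t   = λ t → trans (h-even {2 * suc t} (s≤s z≤n)) (even-digit (suc t))
  ; case-4t+2 = λ t → trans (h-even {suc (2 * t)} (s≤s z≤n)) (odd-digit t)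
  ; case-8t+1 = λ t → trans (h-odd-even (2 * t)) (even-digit t)
  ; case-8t+3 = λ t → trans (h-odd-odd (2 * t)) (odd-digit t)
  ; case-8t+5 = λ t → trans (h-odd-even (suc (2 * t))) (odd-digit t)
  ; case-8t+7 = λ t → trans (h-odd-odd (suc (2 * t))) (odd-digit′ t)
  }
  where
    even-digit : ∀ t {x} → iverson (lowBit (2 * t)) + x ≡ x
    even-digit t = cong (λ b → iverson b + _) (lowBit-even t)
    odd-digit : ∀ t {x} → iverson (lowBit (suc (2 * t))) + x ≡ x + 1
    odd-digit t {x} = trans (cong (λ b → iverson (not b) + x) (lowBit-even t)) (+-comm 1 x)
    odd-digit′ : ∀ t {x} → iverson (not (lowBit (suc (2 * t)))) + x ≡ x
    odd-digit′ t {x} = trans (cong (λ b → iverson b + x) (not-involutive (lowBit (2 * t)))) (even-digit t)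

form-4t : ∀ t → 2 * (2 * t) ≡ 0 + t * 4
form-4t = solve-∀

form-4t+2 : ∀ t → 2 * suc (2 * t) ≡ 2 + t * 4
form-4t+2 = solve-∀

form-8t+1 : ∀ t → suc (2 * (2 * (2 * t))) ≡ 1 + t * 8
form-8t+1 = solve-∀

form-8t+3 : ∀ t → suc (2 * suc (2 * (2 * t))) ≡ 3 + t * 8
form-8t+3 = solve-∀

form-8t+5 : ∀ t → suc (2 * (2 * suc (2 * t))) ≡ 5 + t * 8
form-8t+5 = solve-∀

form-8t+7 : ∀ t → suc (2 * suc (2 * suc (2 * t))) ≡ 7 + t * 8
form-8t+7 = solve-∀

[2*m]/2≡m : ∀ m → (2 * m) / 2 ≡ m
[2*m]/2≡m m = trans (cong (_/ 2) (*-comm 2 m)) (m*n/n≡m m 2)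

[1+2*m+1]/2≡1+m : ∀ m → (suc (2 * m) + 1) / 2 ≡ suc m
[1+2*m+1]/2≡1+m m = trans (cong (_/ 2) (trans (+-comm (suc (2 * m)) 1) (sym (*-suc 2 m)))) ([2*m]/2≡m (suc m))

recurrence⇒residueRecurrence : ∀ {g} → (∀ n → 1 ≤ n → Recurrence g n) → ResidueRecurrence g
recurrence⇒residueRecurrence {g} rec = record
  { case-4t   = λ t → let (r , _) = rec (2 * (2 * suc t)) (s≤s z≤n) in
      trans (r (n≡r+q*m⇒n%m≡r 0 (suc t) 4 (s≤s z≤n) (form-4t (suc t))))
            (cong g ([2*m]/2≡m (2 * suc t)))
  ; case-4t+2 = λ t → let (_ , r , _) = rec (2 * suc (2 * t)) (s≤s z≤n) in
      trans (r (n≡r+q*m⇒n%m≡r 2 t 4 (s≤s (s≤s (s≤s z≤n))) (form-4t+2 t)))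
            (cong (λ x → g x + 1) ([2*m]/2≡m (suc (2 * t))))
  ; case-8t+1 = λ t → let (_ , _ , r , _) = rec (suc (2 * (2 * (2 * t)))) (s≤s z≤n) in
      trans (r (n≡r+q*m⇒n%m≡r 1 t 8 (s≤s (s≤s z≤n)) (form-8t+1 t)))
            (cong g ([1+2*m+1]/2≡1+m (2 * (2 * t))))
  ; case-8t+3 = λ t → let (_ , _ , _ , r , _) = rec (suc (2 * suc (2 * (2 * t)))) (s≤s z≤n) in
      trans (r (n≡r+q*m⇒n%m≡r 3 t 8 (m≤m+n 4 4) (form-8t+3 t)))
            (cong (λ x → g x + 1) ([2*m]/2≡m (suc (2 * (2 * t)))))
  ; case-8t+5 = λ t → let (_ , _ , _ , _ , r , _) = rec (suc (2 * (2 * suc (2 * t)))) (s≤s z≤n) in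
      trans (r (n≡r+q*m⇒n%m≡r 5 t 8 (m≤m+n 6 2) (form-8t+5 t)))
            (cong (λ x → g x + 1) ([1+2*m+1]/2≡1+m (2 * suc (2 * t))))
  ; case-8t+7 = λ t → let (_ , _ , _ , _ , _ , r) = rec (suc (2 * suc (2 * suc (2 * t)))) (s≤s z≤n) in
      trans (r (n≡r+q*m⇒n%m≡r 7 t 8 ≤-refl (form-8t+7 t)))
            (cong g ([2*m]/2≡m (suc (2 * suc (2 * t)))))
  }

n%k≡r⇒n≡form : ∀ {n k r} .{{_ : NonZero k}} (form : ℕ → ℕ) → (∀ t → form t ≡ r + t * k) →
               n % k ≡ r → n ≡ form (n / k)
n%k≡r⇒n≡form {n} {k} form form≡ n%k≡r =
  trans (m≡m%n+[m/n]*n n k) (trans (cong (_+ (n / k) * k) n%k≡r) (sym (form≡ (n / k))))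

residueRecurrence⇒recurrence : ∀ {g} → ResidueRecurrence g → ∀ n → 1 ≤ n → Recurrence g n
residueRecurrence⇒recurrence {g} G n 1≤n = r0 , r2 , r1 , r3 , r5 , r7
  where
    open ResidueRecurrence G
    r0 : n % 4 ≡ 0 → g n ≡ g (n / 2)
    r0 p = from-4t (n / 4) (n%k≡r⇒n≡form _ form-4t p)
      where
        from-4t : ∀ t → n ≡ 2 * (2 * t) → g n ≡ g (n / 2)
        from-4t zero    n≡0 = ⊥-elim (<-irrefl refl (subst (1 ≤_) n≡0 1≤n))
        from-4t (suc t) n≡  = subst (λ x → g x ≡ g (x / 2)) (sym n≡)
                                    (trans (case-4t t) (cong g (sym ([2*m]/2≡m (2 * suc t)))))
    r2 : n % 4 ≡ 2 → g n ≡ g (n / 2) + 1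
    r2 p = subst (λ x → g x ≡ g (x / 2) + 1) (sym (n%k≡r⇒n≡form _ form-4t+2 p))
                 (trans (case-4t+2 t) (cong (λ x → g x + 1) (sym ([2*m]/2≡m (suc (2 * t))))))
      where t = n / 4
    r1 : n % 8 ≡ 1 → g n ≡ g ((n + 1) / 2)
    r1 p = subst (λ x → g x ≡ g ((x + 1) / 2)) (sym (n%k≡r⇒n≡form _ form-8t+1 p))
                 (trans (case-8t+1 t) (cong g (sym ([1+2*m+1]/2≡1+m (2 * (2 * t))))))
      where t = n / 8
    r3 : n % 8 ≡ 3 → g n ≡ g ((n ∸ 1) / 2) + 1
    r3 p = subst (λ x → g x ≡ g ((x ∸ 1) / 2) + 1) (sym (n%k≡r⇒n≡form _ form-8t+3 p))
                 (trans (case-8t+3 t) (cong (λ x → g x + 1) (sym ([2*m]/2≡m (suc (2 * (2 * t)))))))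
      where t = n / 8
    r5 : n % 8 ≡ 5 → g n ≡ g ((n + 1) / 2) + 1
    r5 p = subst (λ x → g x ≡ g ((x + 1) / 2) + 1) (sym (n%k≡r⇒n≡form _ form-8t+5 p))
                 (trans (case-8t+5 t) (cong (λ x → g x + 1) (sym ([1+2*m+1]/2≡1+m (2 * suc (2 * t))))))
      where t = n / 8
    r7 : n % 8 ≡ 7 → g n ≡ g ((n ∸ 1) / 2)
    r7 p = subst (λ x → g x ≡ g ((x ∸ 1) / 2)) (sym (n%k≡r⇒n≡form _ form-8t+7 p))
                 (trans (case-8t+7 t) (cong g (sym ([2*m]/2≡m (suc (2 * suc (2 * t)))))))
      where t = n / 8

n<2*n : ∀ n → 1 ≤ n → n < 2 * n
n<2*n n 1≤n = m<m+n n (≤-trans 1≤n (m≤m+n n 0))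

n<1+2*n : ∀ n → n < suc (2 * n)
n<1+2*n n = s≤s (m≤m+n n (n + 0))

residueRecurrence-unique : ∀ {g g′} → ResidueRecurrence g → ResidueRecurrence g′ → g 1 ≡ g′ 1 →
                           ∀ n → 1 ≤ n → g n ≡ g′ n
residueRecurrence-unique {g} {g′} G G′ g1≡g′1 = <-rec _ agree
  where
    module G  = ResidueRecurrence G
    module G′ = ResidueRecurrence G′
    via : ∀ {n} m (f : ℕ → ℕ) → g n ≡ f (g m) → g′ n ≡ f (g′ m) → g m ≡ g′ m → g n ≡ g′ n
    via m f p p′ e = trans p (trans (cong f e) (sym p′))
    agree : ∀ n → (∀ {m} → m < n → 1 ≤ m → g m ≡ g′ m) → 1 ≤ n → g n ≡ g′ n
    agree n ih 1≤n with halving n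
    ... | even k with halving k
    ...   | even zero    = ⊥-elim (<-irrefl refl 1≤n)
    ...   | even (suc t) = via _ id (G.case-4t t) (G′.case-4t t)
                               (ih (n<2*n (2 * suc t) (s≤s z≤n)) (s≤s z≤n))
    ...   | odd t        = via _ (_+ 1) (G.case-4t+2 t) (G′.case-4t+2 t)
                               (ih (n<2*n (suc (2 * t)) (s≤s z≤n)) (s≤s z≤n))
    agree n ih 1≤n | odd k with halving k
    ...   | even j with halving j
    ...     | even zero    = g1≡g′1
    ...     | even (suc t) = via _ id (G.case-8t+1 (suc t)) (G′.case-8t+1 (suc t))
                                 (ih (s<s (n<2*n (2 * (2 * suc t)) (s≤s z≤n))) (s≤s z≤n))
    ...     | odd t        = via _ (_+ 1) (G.case-8t+5 t) (G′.case-8t+5 t)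
                                 (ih (s<s (n<2*n (2 * suc (2 * t)) (s≤s z≤n))) (s≤s z≤n))
    agree n ih 1≤n | odd k | odd j with halving j
    ...     | even t = via _ (_+ 1) (G.case-8t+3 t) (G′.case-8t+3 t)
                           (ih (n<1+2*n (suc (2 * (2 * t)))) (s≤s z≤n))
    ...     | odd t  = via _ id (G.case-8t+7 t) (G′.case-8t+7 t)
                           (ih (n<1+2*n (suc (2 * suc (2 * t)))) (s≤s z≤n))

corollary21 : Σ (ℕ → ℕ) λ h →
      ((n : ℕ) → 1 ≤ n → IsH n (h n))
    × InitialValues h
    × ((n : ℕ) → 1 ≤ n → Recurrence h n)
    × ((g : ℕ → ℕ) → InitialValues g → ((n : ℕ) → 1 ≤ n → Recurrence g n) →
         (n : ℕ) → 1 ≤ n → g n ≡ h n)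
corollary21 =
  h , (λ n _ → h-isH n) , h-initialValues , residueRecurrence⇒recurrence h-residueRecurrence ,
  -- of the initial values only g 1 is needed: the recurrence determines the others
  λ g g-init g-rec →
    residueRecurrence-unique (recurrence⇒residueRecurrence g-rec) h-residueRecurrence (proj₁ g-init)
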